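{- Let $\operatorname{D}$ be a structural dominance. For all types $X,Y,Z:\mathcal U$ and partial functions $f:X\to\mathcal L(Y)$, $g:Y\to\mathcal L(Z)$, if $f$ and $g$ are $\operatorname{D}$-disciplined then so is their Kleisli composite $g\mathbin{\square} f:=g^\sharp\circ f$.
   Context: Type theory: Martin-Löf type theory with universe $\mathcal U$, function extensionality, proposition extensionality and propositional truncations. The lifting (type of partial elements) is $\mathcal L(Y):=\sum_{P:\mathcal U}\operatorname{isProp}(P)\times(P\to Y)$, with components $\operatorname{defined}$ (the proposition $P$) and $\operatorname{value}$. Kleisli extension: for $f:X\to\mathcal L(Y)$, $f^\sharp(P,-,\varphi):=\big(\sum_{p:P}\operatorname{defined}(f(\varphi p)),-,(p,e)\mapsto\operatorname{value}(f(\varphi p))(e)\big)$. A structural dominance is $\operatorname{D}:\mathcal U\to\mathcal U$ with a map $\operatorname{D}(X)\to\operatorname{isProp}(X)$ for all $X$, an element of $\operatorname{D}(1)$, and a map $\prod_{P:\mathcal U}\prod_{Q:P\to\mathcal U}\operatorname{D}(P)\to(\prod_{p:P}\operatorname{D}(Q(p)))\to\operatorname{D}(\sum_{p:P}Q(p))$ (it need not be proposition-valued). $\mathcal L_{\operatorname{D}}(Y):=\sum_{P:\mathcal U}\operatorname{D}(P)\times(P\to Y)$, with $e_{\operatorname{D}}:\mathcal L_{\operatorname{D}}(Y)\to\mathcal L(Y)$, $e_{\operatorname{D}}(P,d,\varphi)=(P,-,\varphi)$, and $\operatorname{tame}(f'):=e_{\operatorname{D}}\circ f'$ for $f':X\to\mathcal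 L_{\operatorname{D}}(Y)$. A map $f:X\to\mathcal L(Y)$ is $\operatorname{D}$-disciplined if $\big\lVert\sum_{f':X\to\mathcal L_{\operatorname{D}}(Y)}\operatorname{tame}(f')=f\big\rVert$. -}

module Defs where

open import Level using (Level; _⊔_; suc; zero; Setω)
open import Data.Unit using (⊤)
open import Data.Product using (Σ; Σ-syntax; _×_; _,_; proj₁; proj₂)
open import Relation.Binary.PropositionalEquality using (_≡_; refl; subst)

-- The universe 𝓤 of the paper is rendered as Set (= Set₀).

isProp : ∀ {ℓ} → Set ℓ → Set ℓ
isProp A = (x y : A) → x ≡ y

FunExt : Setω
FunExt = ∀ {a b} {A : Set a} {B : A → Set b} {f g : (x : A) → B x}
       → ((x : A) → f x ≡ g x) → f ≡ g

PropExt : Set₁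
PropExt = (P Q : Set) → isProp P → isProp Q → (P → Q) → (Q → P) → P ≡ Q

record Truncation : Setω where
  field
    ∥_∥      : ∀ {ℓ} → Set ℓ → Set ℓ
    ∥∥-isProp : ∀ {ℓ} {A : Set ℓ} → isProp ∥ A ∥
    ∣_∣      : ∀ {ℓ} {A : Set ℓ} → A → ∥ A ∥
    ∥∥-rec   : ∀ {ℓ ℓ'} {A : Set ℓ} {B : Set ℓ'} → isProp B → (A → B) → ∥ A ∥ → B

𝓛 : Set → Set₁
𝓛 Y = Σ[ P ∈ Set ] (isProp P × (P → Y))

defined : {Y : Set} → 𝓛 Y → Set
defined (P , _ , _) = P

defined-isProp : {Y : Set} (u : 𝓛 Y) → isProp (defined u)
defined-isProp (_ , i , _) = i

value : {Y : Set} (u : 𝓛 Y) → defined u → Y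
value (_ , _ , φ) = φ

Σ-isProp : {P : Set} {Q : P → Set} → isProp P → ((p : P) → isProp (Q p))
         → isProp (Σ P Q)
Σ-isProp {P} {Q} i j (p , q) (p' , q') with i p p'
... | refl with j p q q'
...   | refl = refl

_♯ : {X Y : Set} → (X → 𝓛 Y) → 𝓛 X → 𝓛 Y
(f ♯) (P , i , φ) =
  ( (Σ[ p ∈ P ] defined (f (φ p)))
  , Σ-isProp i (λ p → defined-isProp (f (φ p)))
  , (λ { (p , e) → value (f (φ p)) e }) )

_□_ : {X Y Z : Set} → (Y → 𝓛 Z) → (X → 𝓛 Y) → X → 𝓛 Z
(g □ f) x = (g ♯) (f x)

record StructuralDominance : Set₁ where
  field
    D       : Set → Set
    D-prop  : (X : Set) → D X → isProp X
    D-one   : D ⊤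
    D-Σ     : (P : Set) (Q : P → Set) → D P → ((p : P) → D (Q p)) → D (Σ P Q)

module _ (Dom : StructuralDominance) where
  open StructuralDominance Dom

  𝓛D : Set → Set₁
  𝓛D Y = Σ[ P ∈ Set ] (D P × (P → Y))

  eD : {Y : Set} → 𝓛D Y → 𝓛 Y
  eD (P , d , φ) = (P , D-prop P d , φ)

  tame : {X Y : Set} → (X → 𝓛D Y) → X → 𝓛 Y
  tame f' x = eD (f' x)

  Disciplined : Truncation → {X Y : Set} → (X → 𝓛 Y) → Set₁
  Disciplined T {X} {Y} f = ∥ Σ[ f' ∈ (X → 𝓛D Y) ] (tame f' ≡ f) ∥
    where open Truncation T

{-# OPTIONS --safe #-}
-- A D-lifting has its own Kleisli extension, built from the closure of D under Σ, and
-- forgetting the D-structure commutes with Kleisli extension: both sides have the same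
-- domain of definition and the same values, and the proofs that the domain is a
-- proposition agree because being a proposition is itself a proposition. Hence the
-- composite of two D-structured refinements refines the composite of the partial maps.
module Submission where

open import Defs
open import Data.Product using (Σ; Σ-syntax; _,_; proj₁; proj₂)
open import Relation.Binary.PropositionalEquality using (_≡_; refl; cong)
open import Axiom.UniquenessOfIdentityProofs using (UIP; module Constant⇒UIP)

isProp⇒UIP : {A : Set} → isProp A → UIP A
isProp⇒UIP i = Constant⇒UIP.≡-irrelevant (λ {x} {y} _ → i x y) (λ _ _ → refl)

isProp-isProp : FunExt → {A : Set} → isProp (isProp A)
isProp-isProp fe i j = fe λ x → fe λ y → isProp⇒UIP i (i x y) (j x y)

module _ (Dom : StructuralDominance) where
  open StructuralDominance Dom

  _♯D : {Y Z : Set} → (Y → 𝓛D Dom Z) → 𝓛D Dom Y → 𝓛D Dom Z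
  (g' ♯D) (P , d , φ) =
    ( (Σ[ p ∈ P ] defined (eD Dom (g' (φ p))))
    , D-Σ P _ d (λ p → proj₁ (proj₂ (g' (φ p))))
    , (λ { (p , e) → value (eD Dom (g' (φ p))) e }) )

  _□D_ : {X Y Z : Set} → (Y → 𝓛D Dom Z) → (X → 𝓛D Dom Y) → X → 𝓛D Dom Z
  (g' □D f') x = (g' ♯D) (f' x)

  eD-♯ : FunExt → {Y Z : Set} (g' : Y → 𝓛D Dom Z) (u : 𝓛D Dom Y)
       → eD Dom ((g' ♯D) u) ≡ (tame Dom g' ♯) (eD Dom u)
  eD-♯ fe g' (P , d , φ) =
    cong (λ i → (Σ[ p ∈ P ] defined (eD Dom (g' (φ p)))) , i
                , (λ { (p , e) → value (eD Dom (g' (φ p))) e }))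
         (isProp-isProp fe _ _)

  tame-□ : FunExt → {X Y Z : Set} (f' : X → 𝓛D Dom Y) (g' : Y → 𝓛D Dom Z)
         → tame Dom (g' □D f') ≡ tame Dom g' □ tame Dom f'
  tame-□ fe f' g' = fe λ x → eD-♯ fe g' (f' x)

lemma5p43 : FunExt → PropExt → (T : Truncation) → (Dom : StructuralDominance)
    → {X Y Z : Set} (f : X → 𝓛 Y) (g : Y → 𝓛 Z)
    → Disciplined Dom T f → Disciplined Dom T g → Disciplined Dom T (g □ f)
lemma5p43 fe _ T Dom {X} {Y} {Z} f g df dg =
  ∥∥-rec ∥∥-isProp (λ (f' , f'-tames) →
    ∥∥-rec ∥∥-isProp (λ (g' , g'-tames) →
      ∣ _□D_ Dom g' f' , composite-tames f' g' f'-tames g'-tames ∣) dg) df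
  where
  open Truncation T

  composite-tames : (f' : X → 𝓛D Dom Y) (g' : Y → 𝓛D Dom Z)
                  → tame Dom f' ≡ f → tame Dom g' ≡ g → tame Dom (_□D_ Dom g' f') ≡ g □ f
  composite-tames f' g' refl refl = tame-□ Dom fe f' g'
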